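{- Let $m\geq 3$ and let $n$ be an even positive integer. Then the stacked-book graph $G=G_{m,n}=S_m\Box P_n$ satisfies $$rn(G)\geq \frac{mn^2}{2}+n-1.$$
   Context: $S_m$ denotes the star on $m$ vertices (one center vertex adjacent to $m-1$ leaves) and $P_n$ the path on $n$ vertices. The stacked-book graph $G_{m,n}=S_m \Box P_n$ is their Cartesian product. For a simple connected graph $G$ with distance $d$ and diameter $\mathrm{diam}(G)$, a radio labeling is a function $f:V(G)\to \mathbb{Z}_{\ge 0}$ such that $|f(u)-f(v)|\geq \mathrm{diam}(G)+1-d(u,v)$ for all distinct $u,v\in V(G)$. The span of $f$ is $\max_{v} f(v)-\min_{v} f(v)$. The radio number $rn(G)$ is the minimum span over all radio labelings of $G$. -}

module Defs where

open import Data.Nat using (ℕ; zero; suc; _+_; _*_; _∸_; _≤_; _⊔_; _⊓_; ∣_-_∣)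
open import Data.Fin using (Fin; toℕ)
open import Data.List using (List; []; _∷_; foldr; map; allFin; cartesianProduct)
open import Data.Product using (_×_; _,_; Σ; ∃)
open import Data.Sum using (_⊎_)
open import Relation.Binary.PropositionalEquality using (_≡_; _≢_)

record Graph : Set₁ where
  field
    V   : Set
    Adj : V → V → Set
open Graph public

data Walk (G : Graph) : V G → V G → ℕ → Set where
  stay : ∀ {u} → Walk G u u 0
  step : ∀ {u w v k} → Adj G u w → Walk G w v k → Walk G u v (suc k)

Dist : (G : Graph) → V G → V G → ℕ → Set
Dist G u v k = Walk G u v k × (∀ j → Walk G u v j → k ≤ j)

Diam : (G : Graph) → ℕ → Set
Diam G D = (∀ u v k → Dist G u v k → k ≤ D) × Σ (V G) λ u → Σ (V G) λ v → Dist G u v D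

IsRadioLabeling : (G : Graph) → ℕ → (V G → ℕ) → Set
IsRadioLabeling G D f =
  ∀ u v k → u ≢ v → Dist G u v k → D + 1 ≤ ∣ f u - f v ∣ + k

Star : ℕ → Graph
Star m = record
  { V = Fin m
  ; Adj = λ a b → a ≢ b × (toℕ a ≡ 0 ⊎ toℕ b ≡ 0) }

Path : ℕ → Graph
Path n = record
  { V = Fin n
  ; Adj = λ i j → toℕ j ≡ suc (toℕ i) ⊎ toℕ i ≡ suc (toℕ j) }

_□_ : Graph → Graph → Graph
G □ H = record
  { V = V G × V H
  ; Adj = λ { (a , i) (b , j) → (a ≡ b × Adj H i j) ⊎ (i ≡ j × Adj G a b) } }

StackedBook : ℕ → ℕ → Graph
StackedBook m n = Star m □ Path n

bookVertices : (m n : ℕ) → List (Fin m × Fin n)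
bookVertices m n = cartesianProduct (allFin m) (allFin n)

maxL : List ℕ → ℕ
maxL = foldr _⊔_ 0

minL : ℕ → List ℕ → ℕ
minL = foldr _⊓_

-- span(f) = max_v f(v) - min_v f(v)  (0 on an empty vertex set)
spanL : List ℕ → ℕ
spanL []       = 0
spanL (x ∷ xs) = (x ⊔ maxL xs) ∸ minL x xs

span : (m n : ℕ) → (Fin m × Fin n → ℕ) → ℕ
span m n f = spanL (map f (bookVertices m n))

-- Order the vertices by their labels. Consecutive labels differ by at least
-- D + 1 - d(u, v) ≥ n + 2 - d(u, v), and d(u, v) ≤ L(u) + L(v), where L is the
-- distance to the centre of the book: the midpoint of the spine (the copy of P_n
-- through the centre of the star). Summing over the mn - 1 consecutive pairs,
-- span ≥ (mn - 1)(n + 2) - 2 ΣL + L(first) + L(last), and for even n every L is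
-- at least 1/2 while 2 ΣL = 2n(m - 1) + mn²/2, which gives mn²/2 + n - 1.
module Submission where

open import Defs
open import Data.Empty using (⊥-elim)
open import Data.Fin using (Fin; zero; suc; toℕ; fromℕ; fromℕ<; _≟_)
open import Data.Fin.Properties using (toℕ-injective; toℕ<n; toℕ-fromℕ; toℕ-fromℕ<)
open import Data.List using (List; []; _∷_; _++_; map; length; tabulate; applyUpTo; allFin; cartesianProduct)
open import Data.List.Membership.Propositional using (_∈_)
open import Data.List.Membership.Propositional.Properties using (∈-map⁺; ∈-cartesianProduct⁺; ∈-allFin)
open import Data.List.Properties using (map-++; map-tabulate; applyUpTo-∷ʳ; length-++; length-map; length-tabulate)
open import Data.List.Relation.Binary.Permutation.Propositional using (↭-sym; ↭⇒↭ₛ)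
open import Data.List.Relation.Binary.Permutation.Propositional.Properties using (↭-length; map⁺)
open import Data.List.Relation.Unary.All using (_∷_)
open import Data.List.Relation.Unary.AllPairs using (AllPairs; _∷_)
open import Data.List.Relation.Unary.Any using (here; there)
open import Data.List.Relation.Unary.Linked using (Linked; _∷_)
open import Data.List.Relation.Unary.Unique.Propositional using (Unique)
import Data.List.Relation.Unary.Unique.Propositional.Properties as Unique
open import Data.Nat using (ℕ; zero; suc; _+_; _*_; _∸_; _≤_; _<_; z≤n; s≤s; ∣_-_∣)
open import Data.Nat.Divisibility using (_∣_; divides)
open import Data.Nat.DivMod using (_/_; m*n/n≡m)
open import Data.Nat.ListAction using (sum)
open import Data.Nat.ListAction.Properties using (sum-++; sum-↭)
open import Data.Nat.Properties hiding (_≟_)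
open import Data.Nat.Tactic.RingSolver using (solve-∀)
open import Data.Product using (Σ; _×_; _,_; proj₁; proj₂)
open import Data.Sum using (inj₁; inj₂)
open import Function using (id)
import Relation.Binary.Construct.On as On
open import Relation.Binary.PropositionalEquality
  using (_≡_; _≢_; refl; sym; trans; cong; cong₂; subst; setoid; module ≡-Reasoning)
open import Relation.Nullary using (yes; no; contradiction)

_++ᵂ_ : ∀ {G : Graph} {u w v k l} → Walk G u w k → Walk G w v l → Walk G u v (k + l)
stay       ++ᵂ q = q
step a p   ++ᵂ q = step a (p ++ᵂ q)

module _ {G : Graph} (δ : V G → V G → ℕ) where

  Lipschitz : Set
  Lipschitz = ∀ {u w} v → Adj G u w → δ u v ≤ suc (δ w v)

  walk-length-≥ : (∀ v → δ v v ≡ 0) → Lipschitz →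
                  ∀ {u v k} → Walk G u v k → δ u v ≤ k
  walk-length-≥ δ-refl δ-step {v = v} stay = ≤-reflexive (δ-refl v)
  walk-length-≥ δ-refl δ-step {v = v} (step adj p) =
    ≤-trans (δ-step v adj) (s≤s (walk-length-≥ δ-refl δ-step p))

  Dist-intro : (∀ v → δ v v ≡ 0) → Lipschitz → (∀ u v → Walk G u v (δ u v)) →
               ∀ u v → Dist G u v (δ u v)
  Dist-intro δ-refl δ-step walk u v = walk u v , λ _ → walk-length-≥ δ-refl δ-step

  module _ (dist : ∀ u v → Dist G u v (δ u v)) where

    Dist⇒refl : ∀ v → δ v v ≡ 0
    Dist⇒refl v = n≤0⇒n≡0 (proj₂ (dist v v) 0 stay)

    Dist⇒Lipschitz : Lipschitz
    Dist⇒Lipschitz {u} {w} v adj = proj₂ (dist u v) _ (step adj (proj₁ (dist w v)))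

module _ {G H : Graph} where

  mapWalkˡ : ∀ {a b k} (i : V H) → Walk G a b k → Walk (G □ H) (a , i) (b , i) k
  mapWalkˡ i stay         = stay
  mapWalkˡ i (step adj p) = step (inj₂ (refl , adj)) (mapWalkˡ i p)

  mapWalkʳ : ∀ {i j k} (a : V G) → Walk H i j k → Walk (G □ H) (a , i) (a , j) k
  mapWalkʳ a stay         = stay
  mapWalkʳ a (step adj p) = step (inj₁ (refl , adj)) (mapWalkʳ a p)

  □-dist : (V G → V G → ℕ) → (V H → V H → ℕ) → V (G □ H) → V (G □ H) → ℕ
  □-dist δG δH (a , i) (b , j) = δG a b + δH i j

  □-Dist : ∀ {δG δH} → (∀ a b → Dist G a b (δG a b)) → (∀ i j → Dist H i j (δH i j)) →
           ∀ u v → Dist (G □ H) u v (□-dist δG δH u v)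
  □-Dist {δG} {δH} distG distH = Dist-intro (□-dist δG δH) refl′ step′ walk
    where
    refl′ : ∀ v → □-dist δG δH v v ≡ 0
    refl′ (a , i) = cong₂ _+_ (Dist⇒refl δG distG a) (Dist⇒refl δH distH i)
    step′ : Lipschitz (□-dist δG δH)
    step′ {a , i} (b , j) (inj₁ (refl , adj)) =
      ≤-trans (+-monoʳ-≤ (δG a b) (Dist⇒Lipschitz δH distH j adj))
              (≤-reflexive (+-suc (δG a b) _))
    step′ {a , i} (b , j) (inj₂ (refl , adj)) =
      +-monoˡ-≤ (δH i j) (Dist⇒Lipschitz δG distG b adj)
    walk : ∀ u v → Walk (G □ H) u v (□-dist δG δH u v)
    walk (a , i) (b , j) = mapWalkˡ i (proj₁ (distG a b)) ++ᵂ mapWalkʳ b (proj₁ (distH i j))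

depth : ∀ {m} → Fin m → ℕ
depth zero    = 0
depth (suc _) = 1

starDist : ∀ {m} → Fin m → Fin m → ℕ
starDist zero    zero    = 0
starDist zero    (suc _) = 1
starDist (suc _) zero    = 1
starDist (suc a) (suc b) with a ≟ b
... | yes _ = 0
... | no  _ = 2

starDist-leaves≤2 : ∀ {m} (a b : Fin m) → starDist (suc a) (suc b) ≤ 2
starDist-leaves≤2 a b with a ≟ b
... | yes _ = z≤n
... | no  _ = ≤-refl

starDist≤depth+depth : ∀ {m} (a b : Fin m) → starDist a b ≤ depth a + depth b
starDist≤depth+depth zero    zero    = z≤n
starDist≤depth+depth zero    (suc _) = ≤-refl
starDist≤depth+depth (suc _) zero    = ≤-refl
starDist≤depth+depth (suc a) (suc b) = starDist-leaves≤2 a b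

starDist-refl : ∀ {m} (a : Fin m) → starDist a a ≡ 0
starDist-refl zero = refl
starDist-refl (suc a) with a ≟ a
... | yes _  = refl
... | no a≢a = ⊥-elim (a≢a refl)

starDist-Lipschitz : ∀ {m} → Lipschitz {Star m} starDist
starDist-Lipschitz {u = zero}  {zero}  _       (0≢0 , _)  = ⊥-elim (0≢0 refl)
starDist-Lipschitz {u = zero}  {suc _} zero    _          = z≤n
starDist-Lipschitz {u = zero}  {suc _} (suc _) _          = s≤s z≤n
starDist-Lipschitz {u = suc _} {zero}  zero    _          = ≤-refl
starDist-Lipschitz {u = suc a} {zero}  (suc c) _          = starDist-leaves≤2 a c
starDist-Lipschitz {u = suc _} {suc _} _       (_ , inj₁ ())
starDist-Lipschitz {u = suc _} {suc _} _       (_ , inj₂ ())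

starWalk : ∀ {m} (a b : Fin m) → Walk (Star m) a b (starDist a b)
starWalk zero    zero    = stay
starWalk zero    (suc b) = step ((λ ()) , inj₁ refl) stay
starWalk (suc a) zero    = step ((λ ()) , inj₂ refl) stay
starWalk (suc a) (suc b) with a ≟ b
... | yes refl = stay
... | no  _    = step {w = zero} ((λ ()) , inj₂ refl) (step ((λ ()) , inj₁ refl) stay)

starDist-Dist : ∀ {m} (a b : Fin m) → Dist (Star m) a b (starDist a b)
starDist-Dist = Dist-intro starDist starDist-refl starDist-Lipschitz starWalk

module _ {n : ℕ} where

  pathDist : Fin n → Fin n → ℕ
  pathDist i j = ∣ toℕ i - toℕ j ∣

  pathDist-Lipschitz : Lipschitz {Path n} pathDist
  pathDist-Lipschitz {i} {i′} j adj =
    ≤-trans (∣-∣-triangle (toℕ i) (toℕ i′) (toℕ j)) (+-monoˡ-≤ (pathDist i′ j) (neighbours adj))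
    where
    ∣x-1+x∣≡1 : ∀ x → ∣ x - suc x ∣ ≡ 1
    ∣x-1+x∣≡1 zero    = refl
    ∣x-1+x∣≡1 (suc x) = ∣x-1+x∣≡1 x
    neighbours : Adj (Path n) i i′ → pathDist i i′ ≤ 1
    neighbours (inj₁ i′≡1+i) = ≤-reflexive (trans (cong (∣_-_∣ (toℕ i)) i′≡1+i) (∣x-1+x∣≡1 (toℕ i)))
    neighbours (inj₂ i≡1+i′) =
      ≤-reflexive (trans (cong (λ t → ∣ t - toℕ i′ ∣) i≡1+i′)
                         (trans (∣-∣-comm (suc (toℕ i′)) (toℕ i′)) (∣x-1+x∣≡1 (toℕ i′))))

  ascend : ∀ k (i j : Fin n) → toℕ j ≡ k + toℕ i → Walk (Path n) i j k
  ascend zero    i j j≡i = subst (λ j → Walk (Path n) i j 0) (toℕ-injective (sym j≡i)) stay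
  ascend (suc k) i j j≡k+1+i = step (inj₁ (toℕ-fromℕ< i+1<n)) (ascend k (fromℕ< i+1<n) j j≡k+i+1)
    where
    i+1<n : suc (toℕ i) < n
    i+1<n = <-≤-trans (s≤s (≤-trans (s≤s (m≤n+m (toℕ i) k)) (≤-reflexive (sym j≡k+1+i)))) (toℕ<n j)
    j≡k+i+1 : toℕ j ≡ k + toℕ (fromℕ< i+1<n)
    j≡k+i+1 = trans j≡k+1+i (trans (sym (+-suc k (toℕ i))) (cong (k +_) (sym (toℕ-fromℕ< i+1<n))))

  descend : ∀ k (i j : Fin n) → toℕ i ≡ k + toℕ j → Walk (Path n) i j k
  descend zero    i j i≡j = subst (λ j → Walk (Path n) i j 0) (toℕ-injective i≡j) stay
  descend (suc k) i j i≡k+1+j =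
    step (inj₂ (trans i≡k+1+j (cong suc (sym (toℕ-fromℕ< k+j<n)))))
         (descend k (fromℕ< k+j<n) j (toℕ-fromℕ< k+j<n))
    where
    k+j<n : k + toℕ j < n
    k+j<n = ≤-trans (≤-reflexive (sym i≡k+1+j)) (<⇒≤ (toℕ<n i))

  pathWalk : ∀ (i j : Fin n) → Walk (Path n) i j (pathDist i j)
  pathWalk i j with ≤-total (toℕ i) (toℕ j)
  ... | inj₁ i≤j = subst (Walk (Path n) i j) (sym (m≤n⇒∣m-n∣≡n∸m i≤j))
                         (ascend _ i j (sym (m∸n+n≡m i≤j)))
  ... | inj₂ j≤i = subst (Walk (Path n) i j) (sym (m≤n⇒∣n-m∣≡n∸m j≤i))
                         (descend _ i j (sym (m∸n+n≡m j≤i)))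

  pathDist-Dist : ∀ (i j : Fin n) → Dist (Path n) i j (pathDist i j)
  pathDist-Dist = Dist-intro pathDist (λ i → ∣n-n∣≡0 (toℕ i)) pathDist-Lipschitz pathWalk

bookDist : ∀ {m n} → Fin m × Fin n → Fin m × Fin n → ℕ
bookDist {m} {n} = □-dist {Star m} {Path n} starDist pathDist

bookDist-Dist : ∀ {m n} (u v : Fin m × Fin n) → Dist (StackedBook m n) u v (bookDist u v)
bookDist-Dist = □-Dist starDist-Dist pathDist-Dist

module _ {m n : ℕ} where

  -- Twice the distance to the centre of the book, which lies halfway along the
  -- spine, at position (n - 1)/2.
  level : Fin m × Fin n → ℕ
  level (a , i) = 2 * depth a + ∣ suc (2 * toℕ i) - n ∣

  2*bookDist≤level+level : ∀ (u v : Fin m × Fin n) → 2 * bookDist u v ≤ level u + level v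
  2*bookDist≤level+level (a , i) (b , j) = begin
    2 * (starDist a b + ∣ I - J ∣)           ≡⟨ *-distribˡ-+ 2 (starDist a b) _ ⟩
    2 * starDist a b + 2 * ∣ I - J ∣         ≤⟨ +-mono-≤ (*-monoʳ-≤ 2 (starDist≤depth+depth a b)) viaMiddle ⟩
    2 * (depth a + depth b) + (∣ suc (2 * I) - n ∣ + ∣ suc (2 * J) - n ∣)
      ≡⟨ regroup (depth a) (depth b) _ _ ⟩
    level (a , i) + level (b , j)            ∎
    where
    open ≤-Reasoning
    regroup : ∀ x y p q → 2 * (x + y) + (p + q) ≡ (2 * x + p) + (2 * y + q)
    regroup = solve-∀
    I = toℕ i
    J = toℕ j
    viaMiddle : 2 * ∣ I - J ∣ ≤ ∣ suc (2 * I) - n ∣ + ∣ suc (2 * J) - n ∣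
    viaMiddle = begin
      2 * ∣ I - J ∣                              ≡⟨ *-distribˡ-∣-∣ 2 I J ⟩
      ∣ suc (2 * I) - suc (2 * J) ∣              ≤⟨ ∣-∣-triangle (suc (2 * I)) n (suc (2 * J)) ⟩
      ∣ suc (2 * I) - n ∣ + ∣ n - suc (2 * J) ∣  ≡⟨ cong (∣ suc (2 * I) - n ∣ +_) (∣-∣-comm n (suc (2 * J))) ⟩
      ∣ suc (2 * I) - n ∣ + ∣ suc (2 * J) - n ∣  ∎

  level-positive : ∀ {k} → n ≡ 2 * k → (u : Fin m × Fin n) → 1 ≤ level u
  level-positive {k} n≡2k (a , i) = ≤-trans (n≢0⇒n>0 odd≢n) (m≤n+m _ (2 * depth a))
    where
    odd≢n : ∣ suc (2 * toℕ i) - n ∣ ≢ 0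
    odd≢n eq = even≢odd k (toℕ i) (sym (trans (∣m-n∣≡0⇒m≡n eq) n≡2k))

sum-map-cartesianProduct : ∀ {A B : Set} (g : A → ℕ) (h : B → ℕ) (xs : List A) (ys : List B) →
  sum (map (λ p → g (proj₁ p) + h (proj₂ p)) (cartesianProduct xs ys))
    ≡ length ys * sum (map g xs) + length xs * sum (map h ys)
sum-map-cartesianProduct g h [] ys = sym (trans (+-identityʳ _) (*-zeroʳ (length ys)))
sum-map-cartesianProduct g h (x ∷ xs) ys = begin
  sum (map F (map (x ,_) ys ++ cartesianProduct xs ys))
    ≡⟨ cong sum (map-++ F (map (x ,_) ys) _) ⟩
  sum (map F (map (x ,_) ys) ++ map F (cartesianProduct xs ys))
    ≡⟨ sum-++ (map F (map (x ,_) ys)) _ ⟩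
  sum (map F (map (x ,_) ys)) + sum (map F (cartesianProduct xs ys))
    ≡⟨ cong₂ _+_ (row ys) (sum-map-cartesianProduct g h xs ys) ⟩
  (length ys * g x + sum (map h ys)) + (length ys * sum (map g xs) + length xs * sum (map h ys))
    ≡⟨ regroup (length ys) (g x) (sum (map g xs)) (length xs) (sum (map h ys)) ⟩
  length ys * (g x + sum (map g xs)) + suc (length xs) * sum (map h ys) ∎
  where
  open ≡-Reasoning
  F = λ p → g (proj₁ p) + h (proj₂ p)
  row : ∀ ys → sum (map F (map (x ,_) ys)) ≡ length ys * g x + sum (map h ys)
  row []       = refl
  row (y ∷ ys) = trans (cong (g x + h y +_) (row ys)) (expand (g x) (h y) (length ys) (sum (map h ys)))
    where
    expand : ∀ a b c d → a + b + (c * a + d) ≡ suc c * a + (b + d)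
    expand = solve-∀
  regroup : ∀ L a s M t → (L * a + t) + (L * s + M * t) ≡ L * (a + s) + suc M * t
  regroup = solve-∀

length-cartesianProduct : ∀ {A B : Set} (xs : List A) (ys : List B) →
  length (cartesianProduct xs ys) ≡ length xs * length ys
length-cartesianProduct []       ys = refl
length-cartesianProduct (x ∷ xs) ys =
  trans (length-++ (map (x ,_) ys)) (cong₂ _+_ (length-map (x ,_) ys) (length-cartesianProduct xs ys))

tabulate-toℕ : ∀ {A : Set} n (g : ℕ → A) → tabulate {n = n} (λ i → g (toℕ i)) ≡ applyUpTo g n
tabulate-toℕ zero    g = refl
tabulate-toℕ (suc n) g = cong (g 0 ∷_) (tabulate-toℕ n (λ x → g (suc x)))

sum-tabulate-const : ∀ l c → sum (tabulate {n = l} (λ _ → c)) ≡ l * c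
sum-tabulate-const zero    c = refl
sum-tabulate-const (suc l) c = cong (c +_) (sum-tabulate-const l c)

sum-applyUpTo-cong : ∀ {f g : ℕ → ℕ} n → (∀ x → f x ≡ g x) → sum (applyUpTo f n) ≡ sum (applyUpTo g n)
sum-applyUpTo-cong zero    f≗g = refl
sum-applyUpTo-cong (suc n) f≗g = cong₂ _+_ (f≗g 0) (sum-applyUpTo-cong n (λ x → f≗g (suc x)))

sum-applyUpTo-suc : ∀ (f : ℕ → ℕ) n → sum (applyUpTo f (suc n)) ≡ sum (applyUpTo f n) + f n
sum-applyUpTo-suc f n = begin
  sum (applyUpTo f (suc n))              ≡⟨ cong sum (sym (applyUpTo-∷ʳ f n)) ⟩
  sum (applyUpTo f n ++ f n ∷ [])        ≡⟨ sum-++ (applyUpTo f n) _ ⟩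
  sum (applyUpTo f n) + (f n + 0)        ≡⟨ cong (sum (applyUpTo f n) +_) (+-identityʳ (f n)) ⟩
  sum (applyUpTo f n) + f n              ∎
  where open ≡-Reasoning

sum-odd : ∀ b → sum (applyUpTo (λ x → suc (2 * x)) b) ≡ b * b
sum-odd zero    = refl
sum-odd (suc b) = trans (sum-applyUpTo-suc (λ x → suc (2 * x)) b)
                        (trans (cong (_+ suc (2 * b)) (sum-odd b)) (square-suc b))
  where
  square-suc : ∀ b → b * b + suc (2 * b) ≡ suc b * suc b
  square-suc = solve-∀

sum-∣odd-even∣ : ∀ a b → sum (applyUpTo (λ x → ∣ suc (2 * x) - 2 * a ∣) (a + b)) ≡ a * a + b * b
sum-∣odd-even∣ zero    b = sum-odd b
sum-∣odd-even∣ (suc a) b = begin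
  ∣ 1 - 2 * suc a ∣ + sum (applyUpTo (λ x → ∣ suc (2 * suc x) - 2 * suc a ∣) (a + b))
    ≡⟨ cong₂ _+_ (cong (∣ 1 -_∣) (*-suc 2 a)) (sum-applyUpTo-cong (a + b) shift) ⟩
  suc (2 * a) + sum (applyUpTo (λ x → ∣ suc (2 * x) - 2 * a ∣) (a + b))
    ≡⟨ cong (suc (2 * a) +_) (sum-∣odd-even∣ a b) ⟩
  suc (2 * a) + (a * a + b * b)
    ≡⟨ square-suc a (b * b) ⟩
  suc a * suc a + b * b ∎
  where
  open ≡-Reasoning
  shift : ∀ x → ∣ suc (2 * suc x) - 2 * suc a ∣ ≡ ∣ suc (2 * x) - 2 * a ∣
  shift x = cong₂ (λ p q → ∣ suc p - q ∣) (*-suc 2 x) (*-suc 2 a)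
  square-suc : ∀ a c → suc (2 * a) + (a * a + c) ≡ suc a * suc a + c
  square-suc = solve-∀

length-bookVertices : ∀ m n → length (bookVertices m n) ≡ m * n
length-bookVertices m n = trans (length-cartesianProduct (allFin m) (allFin n))
                                (cong₂ _*_ (length-tabulate {n = m} id) (length-tabulate {n = n} id))

sum-level : ∀ l k → sum (map level (bookVertices (suc l) (2 * k))) ≡ 2 * k * (l * 2) + suc l * (k * k + k * k)
sum-level l k = begin
  sum (map level (bookVertices (suc l) (2 * k)))
    ≡⟨ sum-map-cartesianProduct twiceDepth pathLevel (allFin (suc l)) (allFin (2 * k)) ⟩
  length (allFin (2 * k)) * sum (map twiceDepth (allFin (suc l)))
    + length (allFin (suc l)) * sum (map pathLevel (allFin (2 * k)))
    ≡⟨ cong₂ _+_ (cong₂ _*_ (length-tabulate {n = 2 * k} id) starSum)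
                 (cong₂ _*_ (length-tabulate {n = suc l} id) pathSum) ⟩
  2 * k * (l * 2) + suc l * (k * k + k * k) ∎
  where
  open ≡-Reasoning
  twiceDepth : Fin (suc l) → ℕ
  twiceDepth a = 2 * depth a
  pathLevel : Fin (2 * k) → ℕ
  pathLevel i = ∣ suc (2 * toℕ i) - 2 * k ∣
  starSum : sum (map twiceDepth (allFin (suc l))) ≡ l * 2
  starSum = trans (cong sum (map-tabulate id twiceDepth)) (sum-tabulate-const l 2)
  pathSum : sum (map pathLevel (allFin (2 * k))) ≡ k * k + k * k
  pathSum = begin
    sum (map pathLevel (allFin (2 * k)))
      ≡⟨ cong sum (trans (map-tabulate id pathLevel) (tabulate-toℕ (2 * k) _)) ⟩
    sum (applyUpTo (λ x → ∣ suc (2 * x) - 2 * k ∣) (k + (k + 0)))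
      ≡⟨ cong (λ b → sum (applyUpTo (λ x → ∣ suc (2 * x) - 2 * k ∣) (k + b))) (+-identityʳ k) ⟩
    sum (applyUpTo (λ x → ∣ suc (2 * x) - 2 * k ∣) (k + k))
      ≡⟨ sum-∣odd-even∣ k k ⟩
    k * k + k * k ∎

lastOf : ∀ {A : Set} → A → List A → A
lastOf x []       = x
lastOf x (y ∷ ys) = lastOf y ys

-- gap says f y - f x ≥ c - (w x + w y)/2, doubled to stay in ℕ.
module SortedLabels {A : Set} (f w : A → ℕ) (c : ℕ)
  (gap : ∀ {x y} → x ≢ y → f x ≤ f y → 2 * f x + 2 * c ≤ 2 * f y + w x + w y) where

  Ascending : List A → Set
  Ascending = Linked (λ x y → f x ≤ f y)

  chain : ∀ {x xs} → Ascending (x ∷ xs) → AllPairs _≢_ (x ∷ xs) →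
          2 * f x + 2 * (length xs * c) + w x + w (lastOf x xs) ≤ 2 * f (lastOf x xs) + 2 * sum (map w (x ∷ xs))
  chain {x} {[]}     _                  _                          = ≤-reflexive (single (f x) (w x))
    where
    single : ∀ a b → 2 * a + 2 * 0 + b + b ≡ 2 * a + 2 * (b + 0)
    single = solve-∀
  chain {x} {y ∷ ys} (fx≤fy ∷ ascending) ((x≢y ∷ _) ∷ distinct) = +-cancelʳ-≤ (2 * f y + w y) _ _ (begin
    2 * f x + 2 * (suc (length ys) * c) + w x + w L + (2 * f y + w y)
      ≡⟨ split (f x) (f y) (length ys) c (w x) (w y) (w L) ⟩
    (2 * f x + 2 * c) + (2 * f y + 2 * (length ys * c) + w y + w L) + w x
      ≤⟨ +-monoˡ-≤ (w x) (+-mono-≤ (gap x≢y fx≤fy) (chain ascending distinct)) ⟩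
    (2 * f y + w x + w y) + (2 * f L + 2 * S) + w x
      ≡⟨ merge (f y) (f L) (w x) (w y) S ⟩
    2 * f L + 2 * (w x + S) + (2 * f y + w y) ∎)
    where
    open ≤-Reasoning
    L = lastOf y ys
    S = sum (map w (y ∷ ys))
    split : ∀ a b k c p q r →
      2 * a + 2 * (suc k * c) + p + r + (2 * b + q) ≡ (2 * a + 2 * c) + (2 * b + 2 * (k * c) + q + r) + p
    split = solve-∀
    merge : ∀ b l p q s → (2 * b + p + q) + (2 * l + 2 * s) + p ≡ 2 * l + 2 * (p + s) + (2 * b + q)
    merge = solve-∀

  module _ (w-positive : ∀ x → 1 ≤ w x) where

    spread : ∀ {x xs} → Ascending (x ∷ xs) → AllPairs _≢_ (x ∷ xs) →
             f x + length xs * c + 1 ≤ f (lastOf x xs) + sum (map w (x ∷ xs))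
    spread {x} {xs} ascending distinct = *-cancelˡ-≤ 2 (begin
      2 * (f x + length xs * c + 1)                  ≡⟨ double (f x) (length xs * c) ⟩
      2 * f x + 2 * (length xs * c) + 1 + 1          ≤⟨ +-mono-≤ (+-monoʳ-≤ _ (w-positive x)) (w-positive L) ⟩
      2 * f x + 2 * (length xs * c) + w x + w L      ≤⟨ chain ascending distinct ⟩
      2 * f L + 2 * sum (map w (x ∷ xs))             ≡⟨ sym (*-distribˡ-+ 2 (f L) _) ⟩
      2 * (f L + sum (map w (x ∷ xs)))               ∎)
      where
      open ≤-Reasoning
      L = lastOf x xs
      double : ∀ a b → 2 * (a + b + 1) ≡ 2 * a + 2 * b + 1 + 1
      double = solve-∀

    open import Data.List.Relation.Binary.Permutation.Setoid.Properties (setoid A) using (Unique-resp-↭)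
    open import Data.List.Sort (On.decTotalOrder ≤-decTotalOrder f) using (sort; sort-↭; sort-↗)

    spread-of-distinct : ∀ (xs : List A) {k} → Unique xs → length xs ≡ suc k →
                         Σ A λ x → Σ A λ y → f x + k * c + 1 ≤ f y + sum (map w xs)
    spread-of-distinct xs {k} unique length≡1+k with sort xs | sort-↭ xs | sort-↗ xs
    ... | []     | σ | _         = contradiction (trans (↭-length σ) length≡1+k) λ ()
    ... | y ∷ ys | σ | ascending = y , lastOf y ys , (begin
      f y + k * c + 1                    ≡⟨ cong (λ t → f y + t * c + 1) (sym length-ys) ⟩
      f y + length ys * c + 1            ≤⟨ spread ascending (Unique-resp-↭ (↭⇒↭ₛ (↭-sym σ)) unique) ⟩
      f (lastOf y ys) + sum (map w (y ∷ ys)) ≡⟨ cong (f (lastOf y ys) +_) (sum-↭ (map⁺ w σ)) ⟩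
      f (lastOf y ys) + sum (map w xs)   ∎)
      where
      open ≤-Reasoning
      length-ys : length ys ≡ k
      length-ys = suc-injective (trans (↭-length σ) length≡1+k)

maxL-≥ : ∀ {x} xs → x ∈ xs → x ≤ maxL xs
maxL-≥ (y ∷ ys) (here refl) = m≤m⊔n y (maxL ys)
maxL-≥ (y ∷ ys) (there x∈ys) = ≤-trans (maxL-≥ ys x∈ys) (m≤n⊔m y (maxL ys))

minL-≤-seed : ∀ y ys → minL y ys ≤ y
minL-≤-seed y []       = ≤-refl
minL-≤-seed y (z ∷ zs) = ≤-trans (m⊓n≤n z _) (minL-≤-seed y zs)

minL-≤ : ∀ {x} y ys → x ∈ y ∷ ys → minL y ys ≤ x
minL-≤ y ys       (here refl)         = minL-≤-seed y ys
minL-≤ y (z ∷ zs) (there (here refl)) = m⊓n≤m z _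
minL-≤ y (z ∷ zs) (there (there x∈zs)) = ≤-trans (m⊓n≤n z _) (minL-≤ y zs (there x∈zs))

spanL-≥ : ∀ {x y} zs → x ∈ zs → y ∈ zs → x ∸ y ≤ spanL zs
spanL-≥ (z ∷ zs) x∈zs y∈zs = ∸-mono (maxL-≥ (z ∷ zs) x∈zs) (minL-≤ z zs y∈zs)

span-≥ : ∀ m n (f : Fin m × Fin n → ℕ) u v → f u ∸ f v ≤ span m n f
span-≥ m n f u v = spanL-≥ (map f (bookVertices m n)) (labelled u) (labelled v)
  where
  labelled : ∀ w → f w ∈ map f (bookVertices m n)
  labelled (a , i) = ∈-map⁺ f (∈-cartesianProduct⁺ (∈-allFin a) (∈-allFin i))

IsRadioLabeling-mono : ∀ {G D D′} {f : V G → ℕ} → D′ ≤ D → IsRadioLabeling G D f → IsRadioLabeling G D′ f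
IsRadioLabeling-mono D′≤D radio u v k u≢v dist = ≤-trans (+-monoˡ-≤ 1 D′≤D) (radio u v k u≢v dist)

stackedBook-diam-≥ : ∀ {m n D} → 3 ≤ m → 1 ≤ n → Diam (StackedBook m n) D → n + 1 ≤ D
stackedBook-diam-≥ {suc (suc (suc _))} {suc n} {D} (s≤s (s≤s (s≤s _))) (s≤s _) (bounded , _) =
  subst (_≤ D) (trans (cong (2 +_) (toℕ-fromℕ n)) (cong suc (+-comm 1 n)))
        (bounded u v _ (bookDist-Dist u v))
  where
  u v : Fin _ × Fin (suc n)
  u = suc zero , zero
  v = suc (suc zero) , fromℕ n

module _ (l h : ℕ) where
  private
    m k n c : ℕ
    m = suc l
    k = suc h
    n = 2 * k
    c = n + 1 + 1

  radio-gap : ∀ {f : Fin m × Fin n → ℕ} → IsRadioLabeling (StackedBook m n) (n + 1) f →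
              ∀ {u v} → u ≢ v → f u ≤ f v → 2 * f u + 2 * c ≤ 2 * f v + level u + level v
  radio-gap {f} radio {u} {v} u≢v fu≤fv = begin
    2 * f u + 2 * c                                    ≤⟨ +-monoʳ-≤ (2 * f u) (*-monoʳ-≤ 2 labelsApart) ⟩
    2 * f u + 2 * (f v ∸ f u + bookDist u v)           ≡⟨ cong (2 * f u +_) (*-distribˡ-+ 2 (f v ∸ f u) _) ⟩
    2 * f u + (2 * (f v ∸ f u) + 2 * bookDist u v)     ≤⟨ +-monoʳ-≤ (2 * f u) (+-monoʳ-≤ (2 * (f v ∸ f u)) (2*bookDist≤level+level u v)) ⟩
    2 * f u + (2 * (f v ∸ f u) + (level u + level v))  ≡⟨ regroup (f u) (f v ∸ f u) (level u) (level v) ⟩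
    2 * (f u + (f v ∸ f u)) + level u + level v        ≡⟨ cong (λ t → 2 * t + level u + level v) (m+[n∸m]≡n fu≤fv) ⟩
    2 * f v + level u + level v                        ∎
    where
    open ≤-Reasoning
    labelsApart : c ≤ f v ∸ f u + bookDist u v
    labelsApart = subst (λ t → c ≤ t + bookDist u v) (m≤n⇒∣m-n∣≡n∸m fu≤fv)
                        (radio u v _ u≢v (bookDist-Dist u v))
    regroup : ∀ a b p q → 2 * a + (2 * b + (p + q)) ≡ 2 * (a + b) + p + q
    regroup = solve-∀

  -- K = mn - 1, T = mn²/2 + n - 1 and S = Σ level, written without subtraction.
  private
    K T S : ℕ
    K = l * n + suc (2 * h)
    T = m * n * k + suc (2 * h)
    S = n * (l * 2) + m * (k * k + k * k)

    size : m * n ≡ suc K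
    size = count l h
      where
      count : ∀ l h → suc l * (2 * suc h) ≡ suc (l * (2 * suc h) + suc (2 * h))
      count = solve-∀

    balance : ∀ a → a + T + S ≡ a + K * c + 1
    balance a = identity a l h
      where
      identity : ∀ a l h → let k = suc h; n = 2 * k in
                 a + (suc l * n * k + suc (2 * h)) + (n * (l * 2) + suc l * (k * k + k * k))
                   ≡ a + (l * n + suc (2 * h)) * (n + 1 + 1) + 1
      identity = solve-∀

  radio-span-≥ : (f : Fin m × Fin n → ℕ) → IsRadioLabeling (StackedBook m n) (n + 1) f →
                 m * n * k + n ∸ 1 ≤ span m n f
  radio-span-≥ f radio
    with SortedLabels.spread-of-distinct f level c (radio-gap radio) (level-positive {k = k} refl) (bookVertices m n) {K}
           (Unique.cartesianProduct⁺ (Unique.allFin⁺ m) (Unique.allFin⁺ n))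
           (trans (length-bookVertices m n) size)
  ... | x , y , spread = begin
    m * n * k + n ∸ 1    ≡⟨ +-∸-assoc (m * n * k) {n} (s≤s z≤n) ⟩
    m * n * k + (n ∸ 1)  ≡⟨ cong (m * n * k +_) (+-suc h (h + 0)) ⟩
    T                    ≡⟨ m+n∸m≡n (f x) T ⟨
    f x + T ∸ f x        ≤⟨ ∸-monoˡ-≤ (f x) fx+T≤fy ⟩
    f y ∸ f x            ≤⟨ span-≥ m n f y x ⟩
    span m n f           ∎
    where
    open ≤-Reasoning
    fx+T≤fy : f x + T ≤ f y
    fx+T≤fy = +-cancelʳ-≤ S _ _ (begin
      f x + T + S                               ≡⟨ balance (f x) ⟩
      f x + K * c + 1                           ≤⟨ spread ⟩
      f y + sum (map level (bookVertices m n))  ≡⟨ cong (f y +_) (sum-level l k) ⟩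
      f y + S                                   ∎)

positive-even : ∀ {n} → 1 ≤ n → 2 ∣ n → Σ ℕ λ h → n ≡ 2 * suc h
positive-even ()  (divides zero    refl)
positive-even _   (divides (suc h) refl) = h , *-comm (suc h) 2

half-of-double : ∀ x k → (x * (2 * k)) / 2 ≡ x * k
half-of-double x k = trans (cong (_/ 2) (reassociate x k)) (m*n/n≡m (x * k) 2)
  where
  reassociate : ∀ x k → x * (2 * k) ≡ x * k * 2
  reassociate = solve-∀

theorem3p4 : (m n : ℕ) → 3 ≤ m → 1 ≤ n → 2 ∣ n →
    (D : ℕ) → Diam (StackedBook m n) D →
    (f : V (StackedBook m n) → ℕ) → IsRadioLabeling (StackedBook m n) D f →
    (m * n * n) / 2 + n ∸ 1 ≤ span m n f
theorem3p4 zero    _ ()  _   _   _ _    _ _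
theorem3p4 (suc l) n 3≤m 1≤n 2∣n D diam f radio with positive-even 1≤n 2∣n
... | h , refl = begin
  (suc l * n * n) / 2 + n ∸ 1  ≡⟨ cong (λ t → t + n ∸ 1) (half-of-double (suc l * n) (suc h)) ⟩
  suc l * n * suc h + n ∸ 1    ≤⟨ radio-span-≥ l h f (IsRadioLabeling-mono {f = f} (stackedBook-diam-≥ 3≤m 1≤n diam) radio) ⟩
  span (suc l) n f             ∎
  where open ≤-Reasoning
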